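{- Let $w$ be a universal Lyndon word of degree $n$ and $u$ a cyclic factor of $w$ of length $k>0$. Then for every total order $\blacktriangleleft$ on $\Sigma_n$ with $\triangleleft_u\subseteq\blacktriangleleft$, the word $u$ is the lexicographically smallest (with respect to $\blacktriangleleft$) among the cyclic factors of $w$ of length $k$.
   Context: $\Sigma_n=\{1,\ldots,n\}$. For a word $w=a_1\cdots a_m$ its conjugates are $w_i=a_i\cdots a_m a_1\cdots a_{i-1}$; a proper conjugate is $w_2w_1$ where $w=w_1w_2$ with $w_1,w_2$ nonempty. A total order on the alphabet induces the lexicographic order on words ($u$ is smaller than $v$ if $u$ is a proper prefix of $v$, or $u=zau'$, $v=zbv'$ with letters $a<b$). A word $w$ over $\Sigma_n$ is a Lyndon word if for some total order on $\Sigma_n$ it is strictly lexicographically smaller than each of its proper conjugates. A universal Lyndon word of degree $n$ is a word over $\Sigma_n$ of length $n!$ all of whose conjugates are Lyndon words. A cyclic factor of $w$ is a nonempty word $u$ with $|u|\le|w|$ that is a factor of $ww$. For a nonempty word $u$, $\mathrm{alp}(u)$ is its set of letters and $\triangleleft_u$ is the relation on $\Sigma_n$: $i\triangleleft_u j$ iff $i\in\mathrm{alp}(u)$ and either $j\notin\mathrm{alp}(u)$ or the first occurrence of $i$ in $u$ precedes that of $j$; $\triangleleft_u\subseteq\blacktriangleleft$ means $i\triangleleft_u j$ implies $i\blacktriangleleft j$. -}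

module Defs where

open import Data.Nat using (ℕ; _≤_; _<_; _!)
open import Data.Fin using (Fin)
open import Data.List using (List; []; _∷_; _++_; length; take; drop)
open import Data.List.Membership.Propositional using (_∈_; _∉_)
open import Data.Product using (Σ; ∃; _×_; _,_)
open import Data.Sum using (_⊎_)
open import Level using (0ℓ)
open import Relation.Nullary using (¬_)
open import Relation.Binary.PropositionalEquality using (_≡_)
open import Relation.Binary using (Rel; IsStrictTotalOrder)

-- The alphabet Σ_n = {1,…,n} is modelled by Fin n; words are lists.
Word : ℕ → Set
Word n = List (Fin n)

TotalOrder : ℕ → Set₁
TotalOrder n = Σ (Rel (Fin n) 0ℓ) λ _◂_ → IsStrictTotalOrder _≡_ _◂_

data Lex< {n : ℕ} (_◂_ : Rel (Fin n) 0ℓ) : Word n → Word n → Set where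
  prefix : ∀ {b v} → Lex< _◂_ [] (b ∷ v)
  here   : ∀ {a b u v} → a ◂ b → Lex< _◂_ (a ∷ u) (b ∷ v)
  there  : ∀ {a u v} → Lex< _◂_ u v → Lex< _◂_ (a ∷ u) (a ∷ v)

Lex≤ : {n : ℕ} → Rel (Fin n) 0ℓ → Word n → Word n → Set
Lex≤ _◂_ u v = u ≡ v ⊎ Lex< _◂_ u v

NonEmpty : {n : ℕ} → Word n → Set
NonEmpty u = ¬ (u ≡ [])

IsLyndon : {n : ℕ} → Word n → Set₁
IsLyndon {n} w = Σ (TotalOrder n) λ { (_◂_ , _) →
  ∀ (w₁ w₂ : Word n) → NonEmpty w₁ → NonEmpty w₂ → w ≡ w₁ ++ w₂ →
    Lex< _◂_ w (w₂ ++ w₁) }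

-- The conjugate w_{i+1} = a_{i+1} ⋯ a_m a_1 ⋯ a_i (0-based shift i).
conjugate : {n : ℕ} → ℕ → Word n → Word n
conjugate i w = drop i w ++ take i w

IsUniversalLyndon : (n : ℕ) → Word n → Set₁
IsUniversalLyndon n w =
  (length w ≡ n !) × (∀ i → i < length w → IsLyndon (conjugate i w))

IsCyclicFactor : {n : ℕ} → Word n → Word n → Set
IsCyclicFactor {n} u w =
  NonEmpty u × length u ≤ length w ×
  ∃ λ (x : Word n) → ∃ λ (y : Word n) → x ++ u ++ y ≡ w ++ w

FirstOcc : {n : ℕ} → Fin n → Word n → Word n → Set
FirstOcc {n} i u p = i ∉ p × ∃ λ (s : Word n) → u ≡ p ++ i ∷ s

◃[_] : {n : ℕ} → Word n → Rel (Fin n) 0ℓ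
◃[_] {n} u i j = i ∈ u ×
  (j ∉ u ⊎ ∃ λ (p : Word n) → ∃ λ (q : Word n) →
     FirstOcc i u p × FirstOcc j u q × length p < length q)

_⊆ʳ_ : {n : ℕ} → Rel (Fin n) 0ℓ → Rel (Fin n) 0ℓ → Set
_⊆ʳ_ R S = ∀ {i j} → R i j → S i j

-- The cyclic factors of w of length at most |w| are the prefixes of its
-- rotations, and in a universal Lyndon word every rotation is Lyndon for an
-- order of its own. If a q b and a q a (a ≠ b) both began rotations, the
-- order ◂ making the rotation r = a q b … Lyndon would satisfy a ◂ b (compare
-- r with its rotation b … a q) and b ◂ a (compare r with the rotation
-- a q a …). So when two cyclic factors z a … and z b … first differ after z,
-- neither a nor b occurs in z, hence a ◃_u b for u = z a …; any order
-- extending ◃_u puts u below z b ….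
module Submission where

open import Defs
open import Data.Nat using (ℕ; _<_; _≤_; z≤n; s≤s)
open import Data.Nat.Properties using (m<m+n; suc-injective)
open import Data.Fin using (Fin)
open import Data.Fin.Properties using (_≟_)
open import Data.List using (List; []; _∷_; _++_; length; take; drop)
open import Data.List.Properties
  using (++-assoc; ++-identityʳ; ++-cancelˡ; length-++; length-++-comm; ∷-injective)
open import Data.List.Membership.Propositional using (_∈_; _∉_)
open import Data.List.Membership.Propositional.Properties using (∈-∃++; ∈-++⁺ʳ; ∈-++⁻)
open import Data.List.Relation.Unary.Any using (here; there)
open import Data.Product using (∃; ∃₂; _×_; _,_; proj₁)
open import Data.Sum using (_⊎_; inj₁; inj₂)
open import Data.Empty using (⊥-elim)
open import Function using (_∘_)
open import Relation.Nullary using (¬_; yes; no)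
open import Relation.Binary
  using (Rel; IsStrictTotalOrder; Irreflexive; Trichotomous; tri<; tri≈; tri>)
open import Relation.Binary.PropositionalEquality
  using (_≡_; _≢_; refl; sym; trans; cong; cong₂; subst)
open import Level using (0ℓ)

module _ {A : Set} where

  ++-split : (a b c d : List A) → a ++ b ≡ c ++ d →
             (∃ λ m → c ≡ a ++ m × b ≡ m ++ d) ⊎ (∃ λ m → a ≡ c ++ m × d ≡ m ++ b)
  ++-split []      b c       d e = inj₁ (c , refl , e)
  ++-split (x ∷ a) b []      d e = inj₂ (x ∷ a , refl , sym e)
  ++-split (x ∷ a) b (y ∷ c) d e with ∷-injective e
  ... | refl , e′ with ++-split a b c d e′
  ...   | inj₁ (m , refl , b≡) = inj₁ (m , refl , b≡)
  ...   | inj₂ (m , refl , d≡) = inj₂ (m , refl , d≡)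

  ++-prefix-of-longer : (u r : List A) {y z : List A} →
                        length u ≤ length r → u ++ y ≡ r ++ z → ∃ λ s → r ≡ u ++ s
  ++-prefix-of-longer []      r       _         _ = r , refl
  ++-prefix-of-longer (a ∷ u) (b ∷ r) (s≤s |u|≤|r|) e with ∷-injective e
  ... | refl , e′ with ++-prefix-of-longer u r |u|≤|r| e′
  ...   | s , refl = s , refl

  drop-length-++ : (a b : List A) → drop (length a) (a ++ b) ≡ b
  drop-length-++ []      b = refl
  drop-length-++ (_ ∷ a) b = drop-length-++ a b

  take-length-++ : (a b : List A) → take (length a) (a ++ b) ≡ a
  take-length-++ []      b = refl
  take-length-++ (x ∷ a) b = cong (x ∷_) (take-length-++ a b)

  Rotation : List A → List A → Set
  Rotation w r = ∃₂ λ w₁ w₂ → w ≡ w₁ ++ w₂ × r ≡ w₂ ++ w₁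

  rotation-sym : ∀ {w r} → Rotation w r → Rotation r w
  rotation-sym (w₁ , w₂ , refl , refl) = w₂ , w₁ , refl , refl

  rotation-trans : ∀ {r₁ w r₂} → Rotation r₁ w → Rotation w r₂ → Rotation r₁ r₂
  rotation-trans (x₁ , x₂ , refl , w≡) (y₁ , y₂ , w≡′ , refl)
    with ++-split x₂ x₁ y₁ y₂ (trans (sym w≡) w≡′)
  ... | inj₁ (m , refl , refl) = m , y₂ ++ x₂ , ++-assoc m y₂ x₂ , sym (++-assoc y₂ x₂ m)
  ... | inj₂ (m , refl , refl) = x₁ ++ y₁ , m , sym (++-assoc x₁ y₁ m) , ++-assoc m x₁ y₁

  rotation-past : ∀ {w} (p : List A) {m t : List A} →
                  Rotation w ((p ++ m) ++ t) → Rotation w (m ++ t ++ p)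
  rotation-past {w} p {m} {t} R =
    subst (Rotation w) (++-assoc m t p)
      (rotation-trans (subst (Rotation w) (++-assoc p m t) R) (p , m ++ t , refl , refl))

  factor-of-square⇒rotation-prefix : ∀ {u w} → length u ≤ length w →
    (x y : List A) → x ++ u ++ y ≡ w ++ w → ∃ λ s → Rotation w (u ++ s)
  factor-of-square⇒rotation-prefix {u} {w} |u|≤|w| x y e with ++-split x (u ++ y) w w e
  ... | inj₂ (m , refl , w≡) = y ++ m , m , u ++ y , w≡ , sym (++-assoc u y m)
  ... | inj₁ (m , refl , uy≡)
    with ++-prefix-of-longer u (m ++ x) (subst (length u ≤_) (length-++-comm x m) |u|≤|w|)
                             (trans uy≡ (sym (++-assoc m x m)))
  ...   | s , mx≡ = s , x , m , refl , sym mx≡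

module _ {n : ℕ} where

  rotation⇒conjugate : ∀ {w r : Word n} → Rotation w r → NonEmpty r →
                       ∃ λ i → i < length w × conjugate i w ≡ r
  rotation⇒conjugate ([] , [] , refl , refl) r≢[] = ⊥-elim (r≢[] refl)
  rotation⇒conjugate (c ∷ w₁ , [] , refl , refl) _ =
    0 , s≤s z≤n , trans (++-identityʳ _) (++-identityʳ _)
  rotation⇒conjugate (w₁ , d ∷ w₂ , refl , refl) _ =
    length w₁ ,
    subst (length w₁ <_) (sym (length-++ w₁)) (m<m+n (length w₁) (s≤s z≤n)) ,
    cong₂ _++_ (drop-length-++ w₁ (d ∷ w₂)) (take-length-++ w₁ (d ∷ w₂))

  universal⇒rotation-lyndon : ∀ {w r : Word n} → IsUniversalLyndon n w →
                              Rotation w r → NonEmpty r → IsLyndon r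
  universal⇒rotation-lyndon (_ , conjugates-lyndon) R r≢[] with rotation⇒conjugate R r≢[]
  ... | i , i<|w| , refl = conjugates-lyndon i i<|w|

module _ {n : ℕ} {_◂_ : Rel (Fin n) 0ℓ} where

  Lex≤-head : ∀ {a b x y} → a ≢ b → Lex≤ _◂_ (a ∷ x) (b ∷ y) → a ◂ b
  Lex≤-head a≢b (inj₁ refl)        = ⊥-elim (a≢b refl)
  Lex≤-head a≢b (inj₂ (here a◂b))  = a◂b
  Lex≤-head a≢b (inj₂ (there _))   = ⊥-elim (a≢b refl)

  Lex<-drop-prefix : Irreflexive _≡_ _◂_ → (p : Word n) {x y : Word n} →
                     Lex< _◂_ (p ++ x) (p ++ y) → Lex< _◂_ x y
  Lex<-drop-prefix irrefl []      x<y        = x<y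
  Lex<-drop-prefix irrefl (c ∷ p) (here c◂c) = ⊥-elim (irrefl refl c◂c)
  Lex<-drop-prefix irrefl (c ∷ p) (there l)  = Lex<-drop-prefix irrefl p l

  Lex≤-drop-prefix : Irreflexive _≡_ _◂_ → (p : Word n) {x y : Word n} →
                     Lex≤ _◂_ (p ++ x) (p ++ y) → Lex≤ _◂_ x y
  Lex≤-drop-prefix irrefl p (inj₁ e) = inj₁ (++-cancelˡ p _ _ e)
  Lex≤-drop-prefix irrefl p (inj₂ l) = inj₂ (Lex<-drop-prefix irrefl p l)

  Lex-total-≡length : Trichotomous _≡_ _◂_ → (u v : Word n) → length u ≡ length v →
                      Lex≤ _◂_ u v ⊎ Lex< _◂_ v u
  Lex-total-≡length compare []      []      _ = inj₁ (inj₁ refl)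
  Lex-total-≡length compare (a ∷ u) (b ∷ v) e with compare a b
  ... | tri< a◂b _ _ = inj₁ (inj₂ (here a◂b))
  ... | tri> _ _ b◂a = inj₂ (here b◂a)
  ... | tri≈ _ refl _ with Lex-total-≡length compare u v (suc-injective e)
  ...   | inj₁ (inj₁ refl) = inj₁ (inj₁ refl)
  ...   | inj₁ (inj₂ u<v)  = inj₁ (inj₂ (there u<v))
  ...   | inj₂ v<u         = inj₂ (there v<u)

  Lex<-first-difference : ∀ {u v : Word n} → length u ≡ length v → Lex< _◂_ u v →
    ∃ λ z → ∃₂ λ a b → ∃₂ λ u′ v′ → u ≡ z ++ a ∷ u′ × v ≡ z ++ b ∷ v′ × a ◂ b
  Lex<-first-difference ()  prefix
  Lex<-first-difference _   (here {a} {b} {u} {v} a◂b) = [] , a , b , u , v , refl , refl , a◂b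
  Lex<-first-difference {c ∷ _} e (there u<v) with Lex<-first-difference (suc-injective e) u<v
  ... | z , a , b , u′ , v′ , refl , refl , a◂b = c ∷ z , a , b , u′ , v′ , refl , refl , a◂b

  lyndon-≤-rotation : ∀ {w r : Word n} →
    (∀ (w₁ w₂ : Word n) → NonEmpty w₁ → NonEmpty w₂ → w ≡ w₁ ++ w₂ → Lex< _◂_ w (w₂ ++ w₁)) →
    Rotation w r → Lex≤ _◂_ w r
  lyndon-≤-rotation minimal ([] , w₂ , refl , refl)          = inj₁ (sym (++-identityʳ w₂))
  lyndon-≤-rotation minimal (w₁ , [] , refl , refl)          = inj₁ (++-identityʳ w₁)
  lyndon-≤-rotation minimal (c ∷ w₁ , d ∷ w₂ , refl , refl) =
    inj₂ (minimal (c ∷ w₁) (d ∷ w₂) (λ ()) (λ ()) refl)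

lyndon-prefix-not-repeated : ∀ {n} {a b : Fin n} {q s s′ : Word n} → a ≢ b →
  IsLyndon (a ∷ q ++ b ∷ s) → ¬ Rotation (a ∷ q ++ b ∷ s) (a ∷ q ++ a ∷ s′)
lyndon-prefix-not-repeated {a = a} {b} {q} {s} a≢b ((_◂_ , sto) , minimal) R = asym a◂b b◂a
  where
  open IsStrictTotalOrder sto using (irrefl; asym)
  a◂b : a ◂ b
  a◂b = Lex≤-head a≢b (lyndon-≤-rotation minimal (a ∷ q , b ∷ s , refl , refl))
  b◂a : b ◂ a
  b◂a = Lex≤-head (a≢b ∘ sym) (Lex≤-drop-prefix irrefl (a ∷ q) (lyndon-≤-rotation minimal R))

rotations-diverge-freshly : ∀ {n} {w z x y : Word n} {a b : Fin n} → IsUniversalLyndon n w →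
  Rotation w (z ++ a ∷ x) → Rotation w (z ++ b ∷ y) → a ≢ b → a ∉ z
rotations-diverge-freshly {a = a} UL R₁ R₂ a≢b a∈z with ∈-∃++ a∈z
... | p , q , refl =
  lyndon-prefix-not-repeated a≢b (universal⇒rotation-lyndon UL R₂′ (λ ()))
    (rotation-trans (rotation-sym R₂′) (rotation-past p R₁))
  where
  R₂′ = rotation-past p R₂

cyclic-factors-diverge-freshly : ∀ {n} {w z x y : Word n} {a b : Fin n} → IsUniversalLyndon n w →
  IsCyclicFactor (z ++ a ∷ x) w → IsCyclicFactor (z ++ b ∷ y) w → a ≢ b → a ∉ z
cyclic-factors-diverge-freshly {z = z} {x} {y} {a} {b} UL (_ , l₁ , x₁ , y₁ , e₁) (_ , l₂ , x₂ , y₂ , e₂)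
  with factor-of-square⇒rotation-prefix l₁ x₁ y₁ e₁ | factor-of-square⇒rotation-prefix l₂ x₂ y₂ e₂
... | s₁ , R₁ | s₂ , R₂ =
  rotations-diverge-freshly UL
    (subst (Rotation _) (++-assoc z (a ∷ x) s₁) R₁)
    (subst (Rotation _) (++-assoc z (b ∷ y) s₂) R₂)

module _ {n : ℕ} where
  open import Data.List.Membership.DecPropositional (_≟_ {n}) using (_∈?_)

  first-occurrence : ∀ {b : Fin n} {xs : Word n} → b ∈ xs → ∃ (FirstOcc b xs)
  first-occurrence (here refl) = [] , (λ ()) , _ , refl
  first-occurrence {b} (there {x = c} b∈xs) with b ≟ c
  ... | yes refl = [] , (λ ()) , _ , refl
  ... | no b≢c with first-occurrence b∈xs
  ...   | p , b∉p , s , refl =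
    c ∷ p , (λ { (here b≡c) → b≢c b≡c ; (there b∈p) → b∉p b∈p }) , s , refl

  ◃-first-difference : ∀ {z u′ : Word n} {a b : Fin n} →
                       a ∉ z → b ∉ z → a ≢ b → ◃[ z ++ a ∷ u′ ] a b
  ◃-first-difference {z} {u′} {a} {b} a∉z b∉z a≢b with b ∈? (z ++ a ∷ u′)
  ... | no b∉u = ∈-++⁺ʳ z (here refl) , inj₁ b∉u
  ... | yes b∈u with ∈-++⁻ z b∈u
  ...   | inj₁ b∈z         = ⊥-elim (b∉z b∈z)
  ...   | inj₂ (here b≡a)  = ⊥-elim (a≢b (sym b≡a))
  ...   | inj₂ (there b∈u′) with first-occurrence b∈u′
  ...     | p , b∉p , t , refl =
    ∈-++⁺ʳ z (here refl) ,
    inj₂ (z , z ++ a ∷ p , (a∉z , p ++ b ∷ t , refl) ,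
          (b∉zap , t , sym (++-assoc z (a ∷ p) (b ∷ t))) ,
          subst (length z <_) (sym (length-++ z)) (m<m+n (length z) (s≤s z≤n)))
    where
    b∉zap : b ∉ z ++ a ∷ p
    b∉zap b∈ with ∈-++⁻ z b∈
    ... | inj₁ b∈z          = b∉z b∈z
    ... | inj₂ (here b≡a)   = a≢b (sym b≡a)
    ... | inj₂ (there b∈p)  = b∉p b∈p

corollary1 : (n : ℕ) (w : Word n) → IsUniversalLyndon n w →
    (u : Word n) → IsCyclicFactor u w →
    (ord : TotalOrder n) → ◃[ u ] ⊆ʳ (proj₁ ord) →
    (v : Word n) → IsCyclicFactor v w → length v ≡ length u →
    Lex≤ (proj₁ ord) u v
corollary1 n w UL u u-factor (_◂_ , sto) ◃u⊆◂ v v-factor |v|≡|u|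
  with Lex-total-≡length (IsStrictTotalOrder.compare sto) u v (sym |v|≡|u|)
... | inj₁ u≤v = u≤v
... | inj₂ v<u with Lex<-first-difference |v|≡|u| v<u
...   | z , b , a , v′ , u′ , refl , refl , b◂a =
  ⊥-elim (asym b◂a (◃u⊆◂ (◃-first-difference a∉z b∉z a≢b)))
  where
  open IsStrictTotalOrder sto using (irrefl; asym)
  a≢b : a ≢ b
  a≢b refl = irrefl refl b◂a
  a∉z : a ∉ z
  a∉z = cyclic-factors-diverge-freshly UL u-factor v-factor a≢b
  b∉z : b ∉ z
  b∉z = cyclic-factors-diverge-freshly UL v-factor u-factor (a≢b ∘ sym)
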